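{- Let $G=G(V,E)$ be a simple graph on $n$ vertices. Then $\varepsilon(G)$ is at most the number of acyclic orientations of the edges of the complement graph $\bar G$. Equality holds if and only if $G$ is a complete $p$-partite graph for some $p\in[n]$.
   Context: For a simple graph $G$, $\varepsilon(G)$ denotes the maximum, over all acyclic orientations of $E$, of the number of linear extensions of the partial order on $V$ induced by the orientation ($u<v$ iff there is a directed path from $u$ to $v$; a linear extension is a bijection $f:V\to[n]$ with $f(u)<f(v)$ whenever $u<v$). -}

module Defs where

open import Data.Bool using (Bool; true; false; not; _∧_; _∨_; _xor_; if_then_else_)
open import Data.Nat using (ℕ; zero; suc; _⊔_; _<ᵇ_)
open import Data.Fin using (Fin; toℕ; _≟_)
open import Data.Fin.Properties using ()
open import Data.List using (List; []; _∷_; [_]; map; concatMap; filterᵇ; length; upTo; allFin; foldr)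
open import Data.Bool.ListAction using (all; any)
open import Data.Vec using (Vec; lookup) renaming ([] to []ᵥ; _∷_ to _∷ᵥ_)
open import Data.Product using (_×_; Σ; ∃)
open import Relation.Nullary using (¬_)
open import Relation.Nullary.Decidable using (⌊_⌋)
open import Relation.Binary.PropositionalEquality using (_≡_)
open import Function.Bundles using (_⇔_)
open import Data.Nat using (_≤_)

Graph : ℕ → Set
Graph n = Fin n → Fin n → Bool

IsSimple : ∀ {n} → Graph n → Set
IsSimple {n} G = (∀ (u v : Fin n) → G u v ≡ G v u) × (∀ (u : Fin n) → G u u ≡ false)

complement : ∀ {n} → Graph n → Graph n
complement G u v = not ⌊ u ≟ v ⌋ ∧ not (G u v)

allVecs : ∀ {A : Set} → List A → (m : ℕ) → List (Vec A m)
allVecs xs zero = [ []ᵥ ]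
allVecs xs (suc m) = concatMap (λ x → map (x ∷ᵥ_) (allVecs xs m)) xs

-- A candidate orientation: arc O u v = true means the arc u → v is present.
Orientation : ℕ → Set
Orientation n = Vec (Vec Bool n) n

arc : ∀ {n} → Orientation n → Fin n → Fin n → Bool
arc O u v = lookup (lookup O u) v

isOrientationOf : ∀ {n} → Graph n → Orientation n → Bool
isOrientationOf {n} G O =
  all (λ u → all (λ v →
    if G u v then (arc O u v xor arc O v u) else not (arc O u v ∨ arc O v u))
    (allFin n)) (allFin n)

walk : ∀ {n} → Orientation n → ℕ → Fin n → Fin n → Bool
walk O zero u v = ⌊ u ≟ v ⌋
walk {n} O (suc k) u v = any (λ w → arc O u w ∧ walk O k w v) (allFin n)

-- u < v: there is a directed walk (equivalently path) of length 1..n from u to v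
precedes : ∀ {n} → Orientation n → Fin n → Fin n → Bool
precedes {n} O u v = any (λ k → walk O (suc k) u v) (upTo n)

isAcyclic : ∀ {n} → Orientation n → Bool
isAcyclic {n} O = all (λ u → not (precedes O u u)) (allFin n)

acyclicOrientations : ∀ {n} → Graph n → List (Orientation n)
acyclicOrientations {n} G =
  filterᵇ (λ O → isOrientationOf G O ∧ isAcyclic O)
          (allVecs (allVecs (true ∷ false ∷ []) n) n)

numAcyclicOrientations : ∀ {n} → Graph n → ℕ
numAcyclicOrientations G = length (acyclicOrientations G)

_⇒ᵇ_ : Bool → Bool → Bool
a ⇒ᵇ b = not a ∨ b

isBijection : ∀ {n} → Vec (Fin n) n → Bool
isBijection {n} f =
  all (λ u → all (λ v → ⌊ lookup f u ≟ lookup f v ⌋ ⇒ᵇ ⌊ u ≟ v ⌋) (allFin n)) (allFin n)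
  ∧ all (λ k → any (λ u → ⌊ lookup f u ≟ k ⌋) (allFin n)) (allFin n)

isLinearExtension : ∀ {n} → Orientation n → Vec (Fin n) n → Bool
isLinearExtension {n} O f =
  isBijection f ∧
  all (λ u → all (λ v → precedes O u v ⇒ᵇ (toℕ (lookup f u) <ᵇ toℕ (lookup f v)))
    (allFin n)) (allFin n)

numLinearExtensions : ∀ {n} → Orientation n → ℕ
numLinearExtensions {n} O = length (filterᵇ (isLinearExtension O) (allVecs (allFin n) n))

ε : ∀ {n} → Graph n → ℕ
ε G = foldr _⊔_ 0 (map numLinearExtensions (acyclicOrientations G))

-- G is complete p-partite: nonempty parts given by a surjection c : V → Fin p,
-- u ~ v iff they lie in different parts
IsCompletePartite : ∀ {n} → Graph n → ℕ → Set
IsCompletePartite {n} G p =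
  Σ (Fin n → Fin p) λ c → (∀ (k : Fin p) → ∃ λ u → c u ≡ k) × (∀ u v → (G u v ≡ true) ⇔ (¬ (c u ≡ c v)))

IsCompleteMultipartite : ∀ {n} → Graph n → Set
IsCompleteMultipartite {n} G = ∃ λ p → (1 ≤ p) × (p ≤ n) × IsCompletePartite G p

module Submission where

-- For an acyclic orientation O of G, send a linear extension
-- f of O to the orientation of Ḡ that points every non-edge from the
-- f-earlier to the f-later vertex.  The edges of G are ordered by O and
-- the non-edges by the image, so f is recovered: the map is injective.  Orient G by part index (O₀).
-- An acyclic orientation A of Ḡ (a disjoint union of cliques) is a total
-- order on each part; O₀ ∪ A is a total order whose ranking is a linear
-- extension of O₀ mapped back to A, so the bound is attained by O₀.  If a ~ b while v is adjacent to neither, the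
-- orientation of Ḡ ranking b < v < a is missed for every O; hence
-- equality forces non-adjacency to be transitive, and its classes are
-- the parts of a complete multipartite structure.

open import Defs
open import Data.Nat using (ℕ; _≤_)
open import Data.Product using (_×_)
open import Relation.Binary.PropositionalEquality using (_≡_)
open import Function.Bundles using (_⇔_)

import Data.Bool as Bool
open import Data.Bool using (Bool; true; false; not; _∧_; _∨_; _xor_; if_then_else_; T)
open import Data.Bool.ListAction using (all; any)
open import Data.Nat using (zero; suc; _+_; _<_; _⊔_; _<ᵇ_; z≤n; s≤s)
import Data.Nat.Properties as ℕ
open import Data.Fin as Fin using (Fin; toℕ; fromℕ<; _≟_)
import Data.Fin.Properties as Fin
open import Data.List
  using (List; []; _∷_; map; concatMap; filterᵇ; length; upTo; allFin; foldr; _++_)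
import Data.List as List
open import Data.List.Properties using (length-++; length-tabulate)
open import Data.List.Membership.Propositional using (_∈_; find; lose)
import Data.List.Membership.Propositional.Properties as ∈
open import Data.List.Relation.Unary.Any using (here; there)
import Data.List.Relation.Unary.Any as Any
import Data.List.Relation.Unary.Any.Properties as Any
open import Data.List.Relation.Unary.All using ([]; _∷_)
import Data.List.Relation.Unary.All as All
import Data.List.Relation.Unary.All.Properties as All
open import Data.List.Relation.Unary.Unique.Propositional using (Unique)
open import Data.List.Relation.Unary.AllPairs using ([]; _∷_)
import Data.List.Relation.Unary.Unique.Propositional.Properties as Unique
open import Data.Vec using (Vec; lookup; tabulate) renaming ([] to []ᵥ; _∷_ to _∷ᵥ_)
import Data.Vec.Properties as Vec
open import Data.Vec.Relation.Binary.Pointwise.Extensional using (ext; Pointwise-≡⇒≡)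
open import Data.Product using (Σ; ∃; _,_; proj₁; proj₂)
open import Data.Sum using (_⊎_; inj₁; inj₂)
open import Data.Empty using (⊥; ⊥-elim)
open import Relation.Nullary using (¬_; yes; no)
open import Relation.Nullary.Decidable using (⌊_⌋; T?)
open import Relation.Binary.PropositionalEquality
  using (refl; sym; trans; cong; cong₂; subst; subst₂; _≢_)
open import Function.Bundles using (mk⇔; Equivalence)
open Equivalence using (to; from)
open import Function using (_∘_)
open import Data.Bool.Properties using (T-≡)
open import Relation.Binary using (tri<; tri≈; tri>)

∧-elim : ∀ {a b : Bool} → a ∧ b ≡ true → a ≡ true × b ≡ true
∧-elim {true} {true} _ = refl , refl

∨-elim : ∀ {a b : Bool} → a ∨ b ≡ true → a ≡ true ⊎ b ≡ true
∨-elim {true} _ = inj₁ refl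
∨-elim {false} e = inj₂ e

∨-introˡ : ∀ {a b : Bool} → a ≡ true → a ∨ b ≡ true
∨-introˡ refl = refl

∨-introʳ : ∀ {a b : Bool} → b ≡ true → a ∨ b ≡ true
∨-introʳ {true} _ = refl
∨-introʳ {false} e = e

⇒ᵇ-elim : ∀ {a b} → (a ⇒ᵇ b) ≡ true → a ≡ true → b ≡ true
⇒ᵇ-elim {true} {true} _ _ = refl

⇒ᵇ-intro : ∀ {a b} → (a ≡ true → b ≡ true) → (a ⇒ᵇ b) ≡ true
⇒ᵇ-intro {false} h = refl
⇒ᵇ-intro {true} h = h refl

<ᵇ-elim : ∀ {a b : ℕ} → (a <ᵇ b) ≡ true → a < b
<ᵇ-elim {a} {b} e = ℕ.<ᵇ⇒< a b (subst T (sym e) _)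

<ᵇ-intro : ∀ {a b : ℕ} → a < b → (a <ᵇ b) ≡ true
<ᵇ-intro {a} {b} lt with a <ᵇ b | ℕ.<⇒<ᵇ lt
... | true | _ = refl

<ᵇ-false : ∀ {a b : ℕ} → b < a → (a <ᵇ b) ≡ false
<ᵇ-false {a} {b} lt with a <ᵇ b in e
... | false = refl
... | true = ⊥-elim (ℕ.<-asym lt (<ᵇ-elim e))

<ᵇ-xor : ∀ {a b : ℕ} → a ≢ b → (a <ᵇ b) xor (b <ᵇ a) ≡ true
<ᵇ-xor {a} {b} a≢b with ℕ.<-cmp a b
... | tri< lt _ _ rewrite <ᵇ-intro lt | <ᵇ-false lt = refl
... | tri≈ _ eq _ = ⊥-elim (a≢b eq)
... | tri> _ _ gt rewrite <ᵇ-intro gt | <ᵇ-false gt = refl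

≟-elim : ∀ {n} {u v : Fin n} → ⌊ u ≟ v ⌋ ≡ true → u ≡ v
≟-elim {u = u} {v} e with u ≟ v
... | yes u≡v = u≡v

≟-intro : ∀ {n} {u v : Fin n} → u ≡ v → ⌊ u ≟ v ⌋ ≡ true
≟-intro {u = u} refl with u ≟ u
... | yes _ = refl
... | no u≢u = ⊥-elim (u≢u refl)

≟-false : ∀ {n} {u v : Fin n} → u ≢ v → ⌊ u ≟ v ⌋ ≡ false
≟-false {u = u} {v} u≢v with u ≟ v
... | yes u≡v = ⊥-elim (u≢v u≡v)
... | no _ = refl

all-elim : ∀ {A : Set} (p : A → Bool) (xs : List A) →
  all p xs ≡ true → ∀ {x} → x ∈ xs → p x ≡ true
all-elim p xs h x∈xs = to T-≡ (All.lookup (All.all⁺ p xs (from T-≡ h)) x∈xs)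

all-intro : ∀ {A : Set} (p : A → Bool) (xs : List A) →
  (∀ {x} → x ∈ xs → p x ≡ true) → all p xs ≡ true
all-intro p xs h = to T-≡ (All.all⁻ p (All.tabulate (λ x∈xs → from T-≡ (h x∈xs))))

any-elim : ∀ {A : Set} (p : A → Bool) (xs : List A) →
  any p xs ≡ true → ∃ λ x → x ∈ xs × p x ≡ true
any-elim p xs h with find (Any.any⁻ p xs (from T-≡ h))
... | x , x∈xs , px = x , x∈xs , to T-≡ px

any-intro : ∀ {A : Set} (p : A → Bool) (xs : List A) {x : A} →
  x ∈ xs → p x ≡ true → any p xs ≡ true
any-intro p xs x∈xs px = to T-≡ (Any.any⁺ p (lose x∈xs (from T-≡ px)))

all²-elim : ∀ {n} (p : Fin n → Fin n → Bool) →
  all (λ u → all (p u) (allFin n)) (allFin n) ≡ true → ∀ u v → p u v ≡ true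
all²-elim {n} p h u v =
  all-elim (p u) (allFin n) (all-elim _ (allFin n) h (∈.∈-allFin u)) (∈.∈-allFin v)

all²-intro : ∀ {n} (p : Fin n → Fin n → Bool) →
  (∀ u v → p u v ≡ true) → all (λ u → all (p u) (allFin n)) (allFin n) ≡ true
all²-intro {n} p h =
  all-intro _ (allFin n) λ {u} _ → all-intro (p u) (allFin n) λ {v} _ → h u v

filterᵇ-intro : ∀ {A : Set} (p : A → Bool) (xs : List A) {x : A} →
  x ∈ xs → p x ≡ true → x ∈ filterᵇ p xs
filterᵇ-intro p xs x∈xs px = ∈.∈-filter⁺ (T? ∘ p) x∈xs (from T-≡ px)

filterᵇ-elim : ∀ {A : Set} (p : A → Bool) (xs : List A) {x : A} →
  x ∈ filterᵇ p xs → x ∈ xs × p x ≡ true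
filterᵇ-elim p xs x∈ with ∈.∈-filter⁻ (T? ∘ p) x∈
... | x∈xs , px = x∈xs , to T-≡ px

delete : ∀ {B : Set} {y : B} (ys : List B) → y ∈ ys →
  ∃ λ (zs : List B) → suc (length zs) ≡ length ys × (∀ {w} → w ∈ ys → w ≢ y → w ∈ zs)
delete {y = y} ys y∈ys with ∈.∈-∃++ y∈ys
... | ys₁ , ys₂ , refl = ys₁ ++ ys₂ , shorter , kept
  where
  shorter : suc (length (ys₁ ++ ys₂)) ≡ length (ys₁ ++ y ∷ ys₂)
  shorter rewrite length-++ ys₁ {ys₂} | length-++ ys₁ {y ∷ ys₂} =
    sym (ℕ.+-suc (length ys₁) (length ys₂))
  kept : ∀ {w} → w ∈ ys₁ ++ y ∷ ys₂ → w ≢ y → w ∈ ys₁ ++ ys₂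
  kept w∈ w≢y with ∈.∈-++⁻ ys₁ w∈
  ... | inj₁ w∈ys₁ = ∈.∈-++⁺ˡ w∈ys₁
  ... | inj₂ (here refl) = ⊥-elim (w≢y refl)
  ... | inj₂ (there w∈ys₂) = ∈.∈-++⁺ʳ ys₁ w∈ys₂

module _ {A B : Set} (φ : A → B) where

  InjectsInto : List A → List B → Set
  InjectsInto xs ys = (∀ {x} → x ∈ xs → φ x ∈ ys)
                    × (∀ {x x'} → x ∈ xs → x' ∈ xs → φ x ≡ φ x' → x ≡ x')

  injects-tail : ∀ {x xs ys zs} → Unique (x ∷ xs) → InjectsInto (x ∷ xs) ys →
    (∀ {w} → w ∈ ys → w ≢ φ x → w ∈ zs) → InjectsInto xs zs
  injects-tail (x∉xs ∷ _) (into , inj) kept =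
    (λ x'∈ → kept (into (there x'∈))
               (λ e → All.lookup x∉xs x'∈ (inj (here refl) (there x'∈) (sym e))))
    , λ x₁∈ x₂∈ → inj (there x₁∈) (there x₂∈)

  count-inj : ∀ xs ys → Unique xs → InjectsInto xs ys → length xs ≤ length ys
  count-inj [] ys _ _ = z≤n
  count-inj (x ∷ xs) ys u@(_ ∷ uxs) inj with delete ys (proj₁ inj (here refl))
  ... | zs , shorter , kept =
    subst (suc (length xs) ≤_) shorter
      (s≤s (count-inj xs zs uxs (injects-tail u inj kept)))

  count-inj< : ∀ xs ys → Unique xs → InjectsInto xs ys →
    ∀ {y} → y ∈ ys → (∀ {x} → x ∈ xs → φ x ≢ y) → length xs < length ys
  count-inj< [] (_ ∷ _) _ _ _ _ = s≤s z≤n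
  count-inj< (x ∷ xs) ys u@(_ ∷ uxs) inj y∈ys missed
    with delete ys (proj₁ inj (here refl))
  ... | zs , shorter , kept =
    subst (suc (length xs) <_) shorter
      (s≤s (count-inj< xs zs uxs (injects-tail u inj kept)
             (kept y∈ys (λ e → missed (here refl) (sym e))) (λ x∈ → missed (there x∈))))

max-map-≤ : ∀ {A : Set} (f : A → ℕ) (xs : List A) {N} →
  (∀ {x} → x ∈ xs → f x ≤ N) → foldr _⊔_ 0 (map f xs) ≤ N
max-map-≤ f [] h = z≤n
max-map-≤ f (x ∷ xs) h = ℕ.⊔-lub (h (here refl)) (max-map-≤ f xs (h ∘ there))

max-map-< : ∀ {A : Set} (f : A → ℕ) (xs : List A) {N} → 0 < N →
  (∀ {x} → x ∈ xs → f x < N) → foldr _⊔_ 0 (map f xs) < N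
max-map-< f [] N>0 h = N>0
max-map-< f (x ∷ xs) N>0 h = ℕ.⊔-lub (h (here refl)) (max-map-< f xs N>0 (h ∘ there))

≤-max-map : ∀ {A : Set} (f : A → ℕ) (xs : List A) {x} →
  x ∈ xs → f x ≤ foldr _⊔_ 0 (map f xs)
≤-max-map f (y ∷ xs) (here refl) = ℕ.m≤m⊔n (f y) _
≤-max-map f (y ∷ xs) (there x∈xs) = ℕ.≤-trans (≤-max-map f xs x∈xs) (ℕ.m≤n⊔m (f y) _)

allVecs-complete : ∀ {A : Set} (xs : List A) (m : ℕ) (v : Vec A m) →
  (∀ i → lookup v i ∈ xs) → v ∈ allVecs xs m
allVecs-complete xs zero []ᵥ _ = here refl
allVecs-complete xs (suc m) (a ∷ᵥ v) h =
  ∈.∈-concatMap⁺ _ (Any.map (λ { refl → ∈.∈-map⁺ (_ ∷ᵥ_) tail∈ }) (h Fin.zero))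
  where
  tail∈ : v ∈ allVecs xs m
  tail∈ = allVecs-complete xs m v (h ∘ Fin.suc)

allVecs-unique : ∀ {A : Set} (xs : List A) (m : ℕ) → Unique xs → Unique (allVecs xs m)
allVecs-unique xs zero _ = [] ∷ []
allVecs-unique {A} xs (suc m) uxs = cons-unique xs uxs
  where
  cons-with : A → List (Vec A (suc m))
  cons-with x = map (x ∷ᵥ_) (allVecs xs m)

  head∈ : ∀ {x w} (ys : List A) → (x ∷ᵥ w) ∈ concatMap cons-with ys → x ∈ ys
  head∈ (y ∷ ys) w∈ with ∈.∈-++⁻ (cons-with y) w∈
  ... | inj₁ w∈y with ∈.∈-map⁻ (y ∷ᵥ_) w∈y
  ...   | _ , _ , refl = here refl
  head∈ (y ∷ ys) w∈ | inj₂ w∈ys = there (head∈ ys w∈ys)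

  cons-unique : ∀ ys → Unique ys → Unique (concatMap cons-with ys)
  cons-unique [] _ = []
  cons-unique (y ∷ ys) (y∉ys ∷ uys) =
    Unique.++⁺ (Unique.map⁺ Vec.∷-injectiveʳ (allVecs-unique xs m uxs))
               (cons-unique ys uys) disjoint
    where
    disjoint : ∀ {v} → v ∈ cons-with y × v ∈ concatMap cons-with ys → ⊥
    disjoint (v∈y , v∈ys) with ∈.∈-map⁻ (y ∷ᵥ_) v∈y
    ... | _ , _ , refl = All.lookup y∉ys (head∈ ys v∈ys) refl

three-distinct⇒2<n : ∀ {n} {a b c : Fin n} → a ≢ b → b ≢ c → a ≢ c → 2 < n
three-distinct⇒2<n {suc (suc (suc _))} _ _ _ = s≤s (s≤s (s≤s z≤n))
three-distinct⇒2<n {1} {Fin.zero} {Fin.zero} a≢b _ _ = ⊥-elim (a≢b refl)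
three-distinct⇒2<n {2} {Fin.zero} {Fin.zero} a≢b _ _ = ⊥-elim (a≢b refl)
three-distinct⇒2<n {2} {Fin.suc Fin.zero} {Fin.suc Fin.zero} a≢b _ _ = ⊥-elim (a≢b refl)
three-distinct⇒2<n {2} {Fin.zero} {Fin.suc Fin.zero} {Fin.zero} _ _ a≢c = ⊥-elim (a≢c refl)
three-distinct⇒2<n {2} {Fin.zero} {Fin.suc Fin.zero} {Fin.suc Fin.zero} _ b≢c _ = ⊥-elim (b≢c refl)
three-distinct⇒2<n {2} {Fin.suc Fin.zero} {Fin.zero} {Fin.zero} _ b≢c _ = ⊥-elim (b≢c refl)
three-distinct⇒2<n {2} {Fin.suc Fin.zero} {Fin.zero} {Fin.suc Fin.zero} _ _ a≢c = ⊥-elim (a≢c refl)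

injective⇒surjective : ∀ {n} (h : Fin n → Fin n) →
  (∀ {u v} → h u ≡ h v → u ≡ v) → ∀ k → ∃ λ u → h u ≡ k
injective⇒surjective {suc m} h injective k with Fin.any? (λ u → h u ≟ k)
... | yes hit = hit
... | no miss = ⊥-elim (ℕ.<-irrefl refl (Fin.injective⇒≤ {f = squeeze} squeeze-injective))
  where
  -- since k is missed, h factors through Fin m
  avoids : ∀ u → k ≢ h u
  avoids u e = miss (u , sym e)
  squeeze : Fin (suc m) → Fin m
  squeeze u = Fin.punchOut (avoids u)
  squeeze-injective : ∀ {u v} → squeeze u ≡ squeeze v → u ≡ v
  squeeze-injective {u} {v} e = injective (Fin.punchOut-injective (avoids u) (avoids v) e)

module _ {n : ℕ} (O : Orientation n) where

  walk-nil : ∀ u → walk O 0 u u ≡ true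
  walk-nil u = ≟-intro refl

  walk-cons : ∀ {u w v} k → arc O u w ≡ true → walk O k w v ≡ true → walk O (suc k) u v ≡ true
  walk-cons {w = w} k u→w w⇝v =
    any-intro _ (allFin n) (∈.∈-allFin w) (cong₂ _∧_ u→w w⇝v)

  walk-uncons : ∀ {u v} k → walk O (suc k) u v ≡ true →
    ∃ λ w → arc O u w ≡ true × walk O k w v ≡ true
  walk-uncons {u} k h with any-elim _ (allFin n) h
  ... | w , _ , e = w , ∧-elim {arc O u w} e

  walk⇒precedes : ∀ {u v} k → k < n → walk O (suc k) u v ≡ true → precedes O u v ≡ true
  walk⇒precedes k k<n = any-intro _ (upTo n) (∈.∈-upTo⁺ k<n)

  arc⇒precedes : ∀ {u v} → arc O u v ≡ true → precedes O u v ≡ true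
  arc⇒precedes {u} {v} u→v =
    walk⇒precedes 0 (ℕ.≤-<-trans z≤n (Fin.toℕ<n u)) (walk-cons 0 u→v (walk-nil v))

  precedes-induction : (R : Fin n → Fin n → Set) → (∀ {u v} → arc O u v ≡ true → R u v) →
    (∀ {u w v} → R u w → R w v → R u v) → ∀ {u v} → precedes O u v ≡ true → R u v
  precedes-induction R arc⇒R R-trans p with any-elim _ (upTo n) p
  ... | k , _ , walk-k = walk⇒R k walk-k
    where
    walk⇒R : ∀ k {u v} → walk O (suc k) u v ≡ true → R u v
    walk⇒R zero h with walk-uncons 0 h
    ... | w , u→w , w≟v with ≟-elim {u = w} w≟v
    ...   | refl = arc⇒R u→w
    walk⇒R (suc k) h with walk-uncons (suc k) h
    ... | w , u→w , w⇝v = R-trans (arc⇒R u→w) (walk⇒R k w⇝v)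

IsAcyclicOrientation : ∀ {n} → Graph n → Orientation n → Set
IsAcyclicOrientation H O = isOrientationOf H O ≡ true × isAcyclic O ≡ true

acyclicOrientations-intro : ∀ {n} (H : Graph n) {O} →
  IsAcyclicOrientation H O → O ∈ acyclicOrientations H
acyclicOrientations-intro {n} H (isOr , isAc) =
  filterᵇ-intro _ _ (allVecs-complete _ n _ λ i → allVecs-complete _ n _ λ j → bool∈ _)
                    (cong₂ _∧_ isOr isAc)
  where
  bool∈ : (b : Bool) → b ∈ true ∷ false ∷ []
  bool∈ true = here refl
  bool∈ false = there (here refl)

acyclicOrientations-elim : ∀ {n} (H : Graph n) {O} →
  O ∈ acyclicOrientations H → IsAcyclicOrientation H O
acyclicOrientations-elim {n} H O∈ =
  ∧-elim (proj₂ (filterᵇ-elim (λ O → isOrientationOf H O ∧ isAcyclic O)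
                              (allVecs (allVecs (true ∷ false ∷ []) n) n) O∈))

acyclicOrientations-unique : ∀ {n} (H : Graph n) → Unique (acyclicOrientations H)
acyclicOrientations-unique {n} H =
  Unique.filter⁺ _ (allVecs-unique _ n (allVecs-unique _ n (((λ ()) ∷ []) ∷ [] ∷ [])))

module AcyclicOrientation {n : ℕ} (H : Graph n) (O : Orientation n)
                          (acyclicOr : IsAcyclicOrientation H O) where

  orients : ∀ u v →
    (if H u v then (arc O u v xor arc O v u) else not (arc O u v ∨ arc O v u)) ≡ true
  orients = all²-elim _ (proj₁ acyclicOr)

  edge⇒arc : ∀ {u v} → H u v ≡ true → arc O u v ≡ true ⊎ arc O v u ≡ true
  edge⇒arc {u} {v} uv with orients u v
  ... | h rewrite uv with arc O u v | arc O v u | h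
  ...   | true  | _    | _ = inj₁ refl
  ...   | false | true | _ = inj₂ refl

  no-arc : ∀ {u v} → H u v ≡ false → arc O u v ≡ false
  no-arc {u} {v} ¬uv with orients u v
  ... | h rewrite ¬uv with arc O u v | h
  ...   | false | _ = refl

  arc⇒edge : ∀ {u v} → arc O u v ≡ true → H u v ≡ true
  arc⇒edge {u} {v} u→v with H u v in uv
  ... | true = refl
  ... | false with trans (sym (no-arc uv)) u→v
  ...   | ()

  arc-antisym : ∀ {u v} → arc O u v ≡ true → arc O v u ≡ true → ⊥
  arc-antisym {u} {v} u→v v→u with orients u v
  ... | h rewrite u→v | v→u with H u v | h
  ...   | true  | ()
  ...   | false | ()

  irreflexive : ∀ u → precedes O u u ≡ false
  irreflexive u with precedes O u u | all-elim _ (allFin n) (proj₂ acyclicOr) (∈.∈-allFin u)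
  ... | false | _ = refl

  -- Acyclicity rules out directed triangles (three distinct vertices are
  -- needed to bound the length of the closed walk by n).
  no-triangle : ∀ {u w v} → u ≢ w → w ≢ v → u ≢ v →
    arc O u w ≡ true → arc O w v ≡ true → arc O v u ≡ true → ⊥
  no-triangle u≢w w≢v u≢v u→w w→v v→u with
    trans (sym (walk⇒precedes O 2 (three-distinct⇒2<n u≢w w≢v u≢v) closed)) (irreflexive _)
    where closed = walk-cons O 2 u→w (walk-cons O 1 w→v (walk-cons O 0 v→u (walk-nil O _)))
  ... | ()

pos : ∀ {n} → Vec (Fin n) n → Fin n → ℕ
pos f u = toℕ (lookup f u)

linearExtensions : ∀ {n} → Orientation n → List (Vec (Fin n) n)
linearExtensions {n} O = filterᵇ (isLinearExtension O) (allVecs (allFin n) n)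

linearExtensions-unique : ∀ {n} (O : Orientation n) → Unique (linearExtensions O)
linearExtensions-unique {n} O = Unique.filter⁺ _ (allVecs-unique _ n (Unique.allFin⁺ n))

module LinearExtension {n : ℕ} {O : Orientation n} {f : Vec (Fin n) n}
                       (f∈ : f ∈ linearExtensions O) where

  private
    isLE : isLinearExtension O f ≡ true
    isLE = proj₂ (filterᵇ-elim (isLinearExtension O) (allVecs (allFin n) n) f∈)

    isBij : isBijection f ≡ true
    isBij = proj₁ (∧-elim {isBijection f} isLE)

    injectivity : ∀ u v → (⌊ lookup f u ≟ lookup f v ⌋ ⇒ᵇ ⌊ u ≟ v ⌋) ≡ true
    injectivity = all²-elim _ (proj₁ (∧-elim isBij))

    covering : ∀ k → any (λ u → ⌊ lookup f u ≟ k ⌋) (allFin n) ≡ true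
    covering k = all-elim _ (allFin n) (proj₂ (∧-elim isBij)) (∈.∈-allFin k)

    order : ∀ u v → (precedes O u v ⇒ᵇ (pos f u <ᵇ pos f v)) ≡ true
    order = all²-elim _ (proj₂ (∧-elim {isBijection f} isLE))

  injective : ∀ {u v} → lookup f u ≡ lookup f v → u ≡ v
  injective {u} {v} e = ≟-elim (⇒ᵇ-elim (injectivity u v) (≟-intro e))

  surjective : ∀ k → ∃ λ u → lookup f u ≡ k
  surjective k with any-elim _ (allFin n) (covering k)
  ... | u , _ , fu≟k = u , ≟-elim fu≟k

  monotone : ∀ {u v} → precedes O u v ≡ true → pos f u < pos f v
  monotone {u} {v} u<v = <ᵇ-elim (⇒ᵇ-elim (order u v) u<v)

-- Conversely, an injective vector monotone for the precedence order is a
-- linear extension (surjectivity follows by the pigeonhole principle).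
linearExtensions-intro : ∀ {n} (O : Orientation n) (f : Vec (Fin n) n) →
  (∀ {u v} → lookup f u ≡ lookup f v → u ≡ v) →
  (∀ {u v} → precedes O u v ≡ true → pos f u < pos f v) → f ∈ linearExtensions O
linearExtensions-intro {n} O f injective monotone =
  filterᵇ-intro (isLinearExtension O) _ (allVecs-complete _ n f (λ i → ∈.∈-allFin _))
    (cong₂ _∧_ (cong₂ _∧_ (all²-intro injectivity-test injectivity) surjectivity)
               (all²-intro order-test monotonicity))
  where
  injectivity-test : Fin n → Fin n → Bool
  injectivity-test u v = ⌊ lookup f u ≟ lookup f v ⌋ ⇒ᵇ ⌊ u ≟ v ⌋
  injectivity : ∀ u v → injectivity-test u v ≡ true
  injectivity u v = ⇒ᵇ-intro λ e → ≟-intro (injective (≟-elim e))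
  surjectivity : all (λ k → any (λ u → ⌊ lookup f u ≟ k ⌋) (allFin n)) (allFin n) ≡ true
  surjectivity = all-intro _ (allFin n) λ {k} _ →
    let u , fu≡k = injective⇒surjective (lookup f) injective k
    in any-intro _ (allFin n) (∈.∈-allFin u) (≟-intro fu≡k)
  order-test : Fin n → Fin n → Bool
  order-test u v = precedes O u v ⇒ᵇ (pos f u <ᵇ pos f v)
  monotonicity : ∀ u v → order-test u v ≡ true
  monotonicity u v = ⇒ᵇ-intro λ u<v → <ᵇ-intro (monotone u<v)

-- If f is onto and g preserves the strict order induced by f, then g
-- places every vertex at least as late as f does: u has toℕ (f u)
-- predecessors under f, and g must keep all of them below g u.
order-preserving⇒≤ : ∀ {n} (f g : Fin n → Fin n) → (∀ k → ∃ λ u → f u ≡ k) →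
  (∀ {u v} → toℕ (f u) < toℕ (f v) → toℕ (g u) < toℕ (g v)) →
  ∀ u → toℕ (f u) ≤ toℕ (g u)
order-preserving⇒≤ {n} f g onto preserves u = below (toℕ (f u)) u refl
  where
  below : ∀ m u → toℕ (f u) ≡ m → m ≤ toℕ (g u)
  below zero u _ = z≤n
  below (suc m) u fu≡1+m = use-predecessor (onto (fromℕ< m<n))
    where
    m<n : m < n
    m<n = ℕ.<-trans (ℕ.n<1+n m) (subst (_< n) fu≡1+m (Fin.toℕ<n (f u)))
    -- the vertex v at position m under f sits below u under g
    use-predecessor : (∃ λ v → f v ≡ fromℕ< m<n) → suc m ≤ toℕ (g u)
    use-predecessor (v , fv≡m) =
      ℕ.≤-<-trans (below m v at-m) (preserves (subst₂ _<_ (sym at-m) (sym fu≡1+m) (ℕ.n<1+n m)))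
      where
      at-m : toℕ (f v) ≡ m
      at-m = trans (cong toℕ fv≡m) (Fin.toℕ-fromℕ< m<n)

same-order⇒≡ : ∀ {n} {O O' : Orientation n} {f g : Vec (Fin n) n} →
  f ∈ linearExtensions O → g ∈ linearExtensions O' →
  (∀ {u v} → pos f u < pos f v → pos g u < pos g v) →
  (∀ {u v} → pos g u < pos g v → pos f u < pos f v) → f ≡ g
same-order⇒≡ {f = f} {g} f∈ g∈ f⇒g g⇒f = Pointwise-≡⇒≡ (ext λ u →
  Fin.toℕ-injective (ℕ.≤-antisym
    (order-preserving⇒≤ (lookup f) (lookup g) (LinearExtension.surjective f∈) f⇒g u)
    (order-preserving⇒≤ (lookup g) (lookup f) (LinearExtension.surjective g∈) g⇒f u)))

-- Ranking the vertices by a strict total order D (given as a Boolean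
-- relation): vertex u gets position  indegree D u , the number of
-- vertices below it.

indegree : ∀ {n} → (Fin n → Fin n → Bool) → Fin n → ℕ
indegree {n} D u = length (filterᵇ (λ w → D w u) (allFin n))

toFinOr : ∀ {n} → ℕ → Fin n → Fin n
toFinOr {n} m d with m ℕ.<? n
... | yes m<n = fromℕ< m<n
... | no _ = d

ranking : ∀ {n} → (Fin n → Fin n → Bool) → Vec (Fin n) n
ranking D = tabulate λ u → toFinOr (indegree D u) u

module Ranking {n : ℕ} (D : Fin n → Fin n → Bool)
  (D-irreflexive : ∀ u → D u u ≡ false)
  (D-transitive : ∀ {u w v} → D u w ≡ true → D w v ≡ true → D u v ≡ true)
  (D-total : ∀ {u v} → u ≢ v → D u v ≡ true ⊎ D v u ≡ true) where

  private
    below : Fin n → List (Fin n)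
    below u = filterᵇ (λ w → D w u) (allFin n)

    below-unique : ∀ u → Unique (below u)
    below-unique u = Unique.filter⁺ _ (Unique.allFin⁺ n)

    not-below-self : ∀ u {w} → w ∈ below u → w ≢ u
    not-below-self u w∈ refl
      with trans (sym (proj₂ (filterᵇ-elim _ (allFin n) w∈))) (D-irreflexive u)
    ... | ()

    below⊆ : ∀ {u v} → D u v ≡ true → InjectsInto (λ w → w) (below u) (below v)
    below⊆ {u} {v} uv =
      (λ w∈ → let w∈all , wu = filterᵇ-elim _ (allFin n) w∈
              in filterᵇ-intro _ (allFin n) w∈all (D-transitive wu uv))
      , λ _ _ e → e

  -- u itself is never below u, hence fewer than n vertices are below u
  indegree<n : ∀ u → indegree D u < n
  indegree<n u = subst (indegree D u <_) (length-tabulate (λ w → w))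
    (count-inj< (λ w → w) (below u) (allFin n) (below-unique u)
       ((λ w∈ → proj₁ (filterᵇ-elim _ (allFin n) w∈)) , λ _ _ e → e) (∈.∈-allFin u)
       (not-below-self u))

  -- if u is below v then everything below u is below v, and so is u
  indegree-monotone : ∀ {u v} → D u v ≡ true → indegree D u < indegree D v
  indegree-monotone {u} {v} uv =
    count-inj< (λ w → w) (below u) (below v) (below-unique u) (below⊆ uv)
      (filterᵇ-intro _ (allFin n) (∈.∈-allFin u) uv)
      (not-below-self u)

  pos-ranking : ∀ u → pos (ranking D) u ≡ indegree D u
  pos-ranking u rewrite Vec.lookup∘tabulate (λ u → toFinOr (indegree D u) u) u
    with indegree D u ℕ.<? n
  ... | yes m<n = Fin.toℕ-fromℕ< m<n
  ... | no m≮n = ⊥-elim (m≮n (indegree<n u))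

  ranking-monotone : ∀ {u v} → D u v ≡ true → pos (ranking D) u < pos (ranking D) v
  ranking-monotone {u} {v} uv =
    subst₂ _<_ (sym (pos-ranking u)) (sym (pos-ranking v)) (indegree-monotone uv)

  ranking-injective : ∀ {u v} → lookup (ranking D) u ≡ lookup (ranking D) v → u ≡ v
  ranking-injective {u} {v} same with u ≟ v
  ... | yes u≡v = u≡v
  ... | no u≢v with D-total u≢v
  ...   | inj₁ uv = ⊥-elim (ℕ.<-irrefl (cong toℕ same) (ranking-monotone uv))
  ...   | inj₂ vu = ⊥-elim (ℕ.<-irrefl (cong toℕ (sym same)) (ranking-monotone vu))

lead : ∀ {n} → Fin n → Fin n → Fin n → Fin n → ℕ
lead x y z w with w ≟ x
... | yes _ = 0
... | no _ with w ≟ y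
...   | yes _ = 1
...   | no _ with w ≟ z
...     | yes _ = 2
...     | no _ = 3 + toℕ w

module _ {n : ℕ} {x y z : Fin n} where

  lead-value : ∀ w → (w ≡ x × lead x y z w ≡ 0) ⊎ (w ≡ y × lead x y z w ≡ 1)
                   ⊎ (w ≡ z × lead x y z w ≡ 2) ⊎ lead x y z w ≡ 3 + toℕ w
  lead-value w with w ≟ x
  ... | yes w≡x = inj₁ (w≡x , refl)
  ... | no _ with w ≟ y
  ...   | yes w≡y = inj₂ (inj₁ (w≡y , refl))
  ...   | no _ with w ≟ z
  ...     | yes w≡z = inj₂ (inj₂ (inj₁ (w≡z , refl)))
  ...     | no _ = inj₂ (inj₂ (inj₂ refl))

  lead-decode : ∀ w → (lead x y z w ≡ 0 → w ≡ x) × (lead x y z w ≡ 1 → w ≡ y)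
                    × (lead x y z w ≡ 2 → w ≡ z) × (∀ m → lead x y z w ≡ 3 + m → toℕ w ≡ m)
  lead-decode w with w ≟ x
  ... | yes w≡x = (λ _ → w≡x) , (λ ()) , (λ ()) , λ _ ()
  ... | no _ with w ≟ y
  ...   | yes w≡y = (λ ()) , (λ _ → w≡y) , (λ ()) , λ _ ()
  ...   | no _ with w ≟ z
  ...     | yes w≡z = (λ ()) , (λ ()) , (λ _ → w≡z) , λ _ ()
  ...     | no _ = (λ ()) , (λ ()) , (λ ()) , λ _ → ℕ.+-cancelˡ-≡ 3 _ _

  lead-injective : ∀ {w w'} → lead x y z w ≡ lead x y z w' → w ≡ w'
  lead-injective {w} {w'} same with lead-decode w | lead-value w'
  ... | at-x , _ , _ , _ | inj₁ (w'≡x , k≡0) =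
    trans (at-x (trans same k≡0)) (sym w'≡x)
  ... | _ , at-y , _ , _ | inj₂ (inj₁ (w'≡y , k≡1)) =
    trans (at-y (trans same k≡1)) (sym w'≡y)
  ... | _ , _ , at-z , _ | inj₂ (inj₂ (inj₁ (w'≡z , k≡2))) =
    trans (at-z (trans same k≡2)) (sym w'≡z)
  ... | _ , _ , _ , at-m | inj₂ (inj₂ (inj₂ k≡3+m)) =
    Fin.toℕ-injective (at-m (toℕ w') (trans same k≡3+m))

  lead-x : lead x y z x ≡ 0
  lead-x with x ≟ x
  ... | yes _ = refl
  ... | no x≢x = ⊥-elim (x≢x refl)

  lead-y : y ≢ x → lead x y z y ≡ 1
  lead-y y≢x with y ≟ x
  ... | yes y≡x = ⊥-elim (y≢x y≡x)
  ... | no _ with y ≟ y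
  ...   | yes _ = refl
  ...   | no y≢y = ⊥-elim (y≢y refl)

  lead-z : z ≢ x → z ≢ y → lead x y z z ≡ 2
  lead-z z≢x z≢y with z ≟ x
  ... | yes z≡x = ⊥-elim (z≢x z≡x)
  ... | no _ with z ≟ y
  ...   | yes z≡y = ⊥-elim (z≢y z≡y)
  ...   | no _ with z ≟ z
  ...     | yes _ = refl
  ...     | no z≢z = ⊥-elim (z≢z refl)

orientBy : ∀ {n} → Graph n → (Fin n → ℕ) → Orientation n
orientBy H key = tabulate λ u → tabulate λ v → H u v ∧ (key u <ᵇ key v)

module _ {n : ℕ} (H : Graph n) (key : Fin n → ℕ) where

  arc-orientBy : ∀ u v → arc (orientBy H key) u v ≡ H u v ∧ (key u <ᵇ key v)
  arc-orientBy u v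
    rewrite Vec.lookup∘tabulate (λ u → tabulate λ v → H u v ∧ (key u <ᵇ key v)) u =
    Vec.lookup∘tabulate (λ v → H u v ∧ (key u <ᵇ key v)) v

  orientBy-arc⇒< : ∀ {u v} → arc (orientBy H key) u v ≡ true → key u < key v
  orientBy-arc⇒< {u} {v} u→v = <ᵇ-elim (proj₂ (∧-elim (trans (sym (arc-orientBy u v)) u→v)))

  orientBy-<⇒arc : ∀ {u v} → H u v ≡ true → key u < key v → arc (orientBy H key) u v ≡ true
  orientBy-<⇒arc {u} {v} uv lt = trans (arc-orientBy u v) (cong₂ _∧_ uv (<ᵇ-intro lt))

  -- If H is symmetric and adjacent vertices have distinct keys, the result
  -- is an acyclic orientation of H (a cycle would strictly increase the key).
  orientBy-acyclic : (∀ u v → H u v ≡ H v u) → (∀ {u v} → H u v ≡ true → key u ≢ key v) →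
    IsAcyclicOrientation H (orientBy H key)
  orientBy-acyclic H-sym key-distinct = all²-intro _ orients , all-intro _ (allFin n) no-cycle
    where
    O : Orientation n
    O = orientBy H key
    orients : ∀ u v →
      (if H u v then (arc O u v xor arc O v u) else not (arc O u v ∨ arc O v u)) ≡ true
    orients u v rewrite arc-orientBy u v | arc-orientBy v u | H-sym v u with H u v in uv
    ... | true = <ᵇ-xor (key-distinct uv)
    ... | false = refl
    no-cycle : ∀ {u} → u ∈ allFin n → not (precedes O u u) ≡ true
    no-cycle {u} _ with precedes O u u in u<u
    ... | false = refl
    ... | true = ⊥-elim (ℕ.<-irrefl refl
                   (precedes-induction O (λ x y → key x < key y) orientBy-arc⇒< ℕ.<-trans u<u))

module Complement {n : ℕ} (G : Graph n) (simple : IsSimple G) where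

  Ḡ : Graph n
  Ḡ = complement G

  G-sym : ∀ u v → G u v ≡ G v u
  G-sym = proj₁ simple

  G-loopless : ∀ u → G u u ≡ false
  G-loopless = proj₂ simple

  G-edge⇒≢ : ∀ {u v} → G u v ≡ true → u ≢ v
  G-edge⇒≢ {u} uv refl with trans (sym uv) (G-loopless u)
  ... | ()

  Ḡ-sym : ∀ u v → Ḡ u v ≡ Ḡ v u
  Ḡ-sym u v = cong₂ (λ a b → not a ∧ not b) (≟-sym u v) (G-sym u v)
    where
    ≟-sym : ∀ (u v : Fin n) → ⌊ u ≟ v ⌋ ≡ ⌊ v ≟ u ⌋
    ≟-sym u v with u ≟ v
    ... | yes refl = sym (≟-intro refl)
    ... | no u≢v = sym (≟-false (u≢v ∘ sym))

  Ḡ-edge⇒≢ : ∀ {u v} → Ḡ u v ≡ true → u ≢ v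
  Ḡ-edge⇒≢ {u} uv refl rewrite ≟-intro (refl {x = u}) with uv
  ... | ()

  Ḡ-edge⇒non-edge : ∀ {u v} → Ḡ u v ≡ true → G u v ≡ false
  Ḡ-edge⇒non-edge {u} {v} uv with ⌊ u ≟ v ⌋ | G u v | uv
  ... | false | false | _ = refl

  non-edge⇒Ḡ-edge : ∀ {u v} → u ≢ v → G u v ≡ false → Ḡ u v ≡ true
  non-edge⇒Ḡ-edge u≢v ¬uv rewrite ≟-false u≢v | ¬uv = refl

  -- On the linear
  -- extensions of O this map is injective: the edges of G are ordered by O
  -- and the non-edges by toḠ f, so f can be recovered from toḠ f.

  toḠ : Vec (Fin n) n → Orientation n
  toḠ f = orientBy Ḡ (pos f)

  module _ {O : Orientation n} (O-acyclic : IsAcyclicOrientation G O) where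
    open AcyclicOrientation G O O-acyclic using (edge⇒arc)

    toḠ-acyclic : ∀ {f} → f ∈ linearExtensions O → toḠ f ∈ acyclicOrientations Ḡ
    toḠ-acyclic f∈ = acyclicOrientations-intro Ḡ (orientBy-acyclic Ḡ _ Ḡ-sym
      λ uv e → Ḡ-edge⇒≢ uv (LinearExtension.injective f∈ (Fin.toℕ-injective e)))

    toḠ-determines-order : ∀ {f g} → f ∈ linearExtensions O → g ∈ linearExtensions O →
      toḠ f ≡ toḠ g → ∀ {u v} → pos f u < pos f v → pos g u < pos g v
    toḠ-determines-order {f} {g} f∈ g∈ same {u} {v} lt with u ≟ v
    ... | yes refl = ⊥-elim (ℕ.<-irrefl refl lt)
    ... | no u≢v with G u v in uv
    ...   | true with edge⇒arc uv
    ...     | inj₁ u→v = LinearExtension.monotone g∈ (arc⇒precedes O u→v)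
    ...     | inj₂ v→u =
      ⊥-elim (ℕ.<-asym lt (LinearExtension.monotone f∈ (arc⇒precedes O v→u)))
    toḠ-determines-order {f} {g} f∈ g∈ same {u} {v} lt | no u≢v | false =
      orientBy-arc⇒< Ḡ (pos g) (subst (λ A → arc A u v ≡ true) same
        (orientBy-<⇒arc Ḡ (pos f) (non-edge⇒Ḡ-edge u≢v uv) lt))

    toḠ-injective : ∀ {f g} → f ∈ linearExtensions O → g ∈ linearExtensions O →
      toḠ f ≡ toḠ g → f ≡ g
    toḠ-injective f∈ g∈ same = same-order⇒≡ f∈ g∈
      (toḠ-determines-order f∈ g∈ same) (toḠ-determines-order g∈ f∈ (sym same))

    toḠ-injects : InjectsInto toḠ (linearExtensions O) (acyclicOrientations Ḡ)
    toḠ-injects = toḠ-acyclic , toḠ-injective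

    linearExtensions≤ : numLinearExtensions O ≤ numAcyclicOrientations Ḡ
    linearExtensions≤ =
      count-inj toḠ _ _ (linearExtensions-unique O) toḠ-injects

  ε≤ : ε G ≤ numAcyclicOrientations Ḡ
  ε≤ = max-map-≤ numLinearExtensions (acyclicOrientations G)
         (linearExtensions≤ ∘ acyclicOrientations-elim G)

-- Orient G by part index (O₀).  The complement is the
-- disjoint union of the cliques on the parts, so an acyclic orientation A
-- of it is a strict total order inside each part; together with O₀ it
-- is a strict total order on all vertices, whose ranking is a linear
-- extension of O₀ from which A is recovered.

module CompleteMultipartite {n : ℕ} (G : Graph n) (simple : IsSimple G)
  {p : ℕ} (c : Fin n → Fin p) (partite : ∀ u v → (G u v ≡ true) ⇔ (¬ c u ≡ c v)) where
  open Complement G simple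

  part : Fin n → ℕ
  part u = toℕ (c u)

  different-parts⇒edge : ∀ {u v} → ¬ c u ≡ c v → G u v ≡ true
  different-parts⇒edge {u} {v} = from (partite u v)

  same-part⇔non-edge : ∀ {u v} → (c u ≡ c v) ⇔ (G u v ≡ false)
  same-part⇔non-edge {u} {v} = mk⇔ same⇒non-edge non-edge⇒same
    where
    same⇒non-edge : c u ≡ c v → G u v ≡ false
    same⇒non-edge same with G u v in uv
    ... | false = refl
    ... | true = ⊥-elim (to (partite u v) uv same)
    non-edge⇒same : G u v ≡ false → c u ≡ c v
    non-edge⇒same ¬uv with c u ≟ c v
    ... | yes same = same
    ... | no different with trans (sym (different-parts⇒edge different)) ¬uv
    ...   | ()

  O₀ : Orientation n
  O₀ = orientBy G part

  O₀-acyclic : IsAcyclicOrientation G O₀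
  O₀-acyclic = orientBy-acyclic G part G-sym
    λ {u} {v} uv e → to (partite u v) uv (Fin.toℕ-injective e)

  O₀-arc : ∀ {u v} → part u < part v → arc O₀ u v ≡ true
  O₀-arc lt = orientBy-<⇒arc G part (different-parts⇒edge (λ e → ℕ.<-irrefl (cong toℕ e) lt)) lt

  merge : Orientation n → Fin n → Fin n → Bool
  merge A u v = arc O₀ u v ∨ arc A u v

  module _ {A : Orientation n} (A-acyclic : IsAcyclicOrientation Ḡ A) where
    open AcyclicOrientation Ḡ A A-acyclic

    A-same-part : ∀ {u v} → arc A u v ≡ true → c u ≡ c v
    A-same-part u→v = from same-part⇔non-edge (Ḡ-edge⇒non-edge (arc⇒edge u→v))

    -- inside a part all pairs are adjacent in Ḡ, so A is transitive there
    A-transitive : ∀ {u w v} → arc A u w ≡ true → arc A w v ≡ true → arc A u v ≡ true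
    A-transitive {u} {w} {v} u→w w→v with u ≟ v
    ... | yes refl = ⊥-elim (arc-antisym u→w w→v)
    ... | no u≢v with edge⇒arc (non-edge⇒Ḡ-edge u≢v
                       (to same-part⇔non-edge (trans (A-same-part u→w) (A-same-part w→v))))
    ...   | inj₁ u→v = u→v
    ...   | inj₂ v→u = ⊥-elim (no-triangle (Ḡ-edge⇒≢ (arc⇒edge u→w))
                                (Ḡ-edge⇒≢ (arc⇒edge w→v)) u≢v u→w w→v v→u)

    merge-≤ : ∀ {u v} → merge A u v ≡ true → part u ≤ part v
    merge-≤ uv with ∨-elim uv
    ... | inj₁ u→v = ℕ.<⇒≤ (orientBy-arc⇒< G part u→v)
    ... | inj₂ u→v = ℕ.≤-reflexive (cong toℕ (A-same-part u→v))

    merge-irreflexive : ∀ u → merge A u u ≡ false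
    merge-irreflexive u =
      cong₂ _∨_ (AcyclicOrientation.no-arc G O₀ O₀-acyclic (G-loopless u))
                (no-arc (trans (cong (λ b → not b ∧ not (G u u)) (≟-intro refl)) refl))

    merge-transitive : ∀ {u w v} → merge A u w ≡ true → merge A w v ≡ true → merge A u v ≡ true
    merge-transitive {u} {w} {v} uw wv with ∨-elim uw | ∨-elim wv
    ... | inj₁ u→w | _ =
      ∨-introˡ (O₀-arc (ℕ.<-≤-trans (orientBy-arc⇒< G part u→w) (merge-≤ wv)))
    ... | inj₂ _ | inj₁ w→v =
      ∨-introˡ (O₀-arc (ℕ.≤-<-trans (merge-≤ uw) (orientBy-arc⇒< G part w→v)))
    ... | inj₂ u→w | inj₂ w→v = ∨-introʳ {arc O₀ u v} (A-transitive u→w w→v)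

    merge-total : ∀ {u v} → u ≢ v → merge A u v ≡ true ⊎ merge A v u ≡ true
    merge-total {u} {v} u≢v with ℕ.<-cmp (part u) (part v)
    ... | tri< lt _ _ = inj₁ (∨-introˡ (O₀-arc lt))
    ... | tri> _ _ gt = inj₂ (∨-introˡ (O₀-arc gt))
    ... | tri≈ _ eq _
      with edge⇒arc (non-edge⇒Ḡ-edge u≢v (to same-part⇔non-edge (Fin.toℕ-injective eq)))
    ...   | inj₁ u→v = inj₁ (∨-introʳ {arc O₀ u v} u→v)
    ...   | inj₂ v→u = inj₂ (∨-introʳ {arc O₀ v u} v→u)

    open Ranking (merge A) merge-irreflexive merge-transitive merge-total

    ranking-linearExtension : ranking (merge A) ∈ linearExtensions O₀
    ranking-linearExtension = linearExtensions-intro O₀ _ ranking-injective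
      (ranking-monotone ∘ precedes-induction O₀ (λ x y → merge A x y ≡ true)
                                             ∨-introˡ merge-transitive)

    -- A is recovered from the ranking: on an edge of Ḡ the arc of A is
    -- the one that goes up in the ranking
    toḠ-ranking : toḠ (ranking (merge A)) ≡ A
    toḠ-ranking = Pointwise-≡⇒≡ (ext λ u → Pointwise-≡⇒≡ (ext λ v →
      trans (arc-orientBy Ḡ (pos r) u v) (recovered u v)))
      where
      r : Vec (Fin n) n
      r = ranking (merge A)
      recovered : ∀ u v → Ḡ u v ∧ (pos r u <ᵇ pos r v) ≡ arc A u v
      recovered u v with Ḡ u v in uv
      ... | false = sym (no-arc uv)
      ... | true with edge⇒arc uv
      ...   | inj₁ u→v =
        trans (<ᵇ-intro (ranking-monotone (∨-introʳ {arc O₀ u v} u→v))) (sym u→v)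
      ...   | inj₂ v→u with arc A u v in u→v
      ...     | true = ⊥-elim (arc-antisym u→v v→u)
      ...     | false = <ᵇ-false (ranking-monotone (∨-introʳ {arc O₀ v u} v→u))

  complement≤ε : numAcyclicOrientations Ḡ ≤ ε G
  complement≤ε = ℕ.≤-trans
    (count-inj (ranking ∘ merge) (acyclicOrientations Ḡ) (linearExtensions O₀)
      (acyclicOrientations-unique Ḡ)
      ( (λ A∈ → ranking-linearExtension (acyclicOrientations-elim Ḡ A∈))
      , λ A∈ A'∈ same → trans (sym (toḠ-ranking (acyclicOrientations-elim Ḡ A∈)))
                          (trans (cong toḠ same) (toḠ-ranking (acyclicOrientations-elim Ḡ A'∈)))))
    (≤-max-map numLinearExtensions (acyclicOrientations G)
      (acyclicOrientations-intro G O₀-acyclic))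

-- Suppose a, b are adjacent in G and v is adjacent to neither.
-- If O orients the edge as a → b, every linear extension f of O has
-- f a < f b, while the orientation of the complement ranking b < v < a
-- would force f b < f v < f a.  So this orientation is missed by toḠ
-- and the count of linear extensions of O is strictly smaller.

module NonTransitiveNonAdjacency {n : ℕ} (G : Graph n) (simple : IsSimple G) where
  open Complement G simple

  complement-has-orientation : 0 < numAcyclicOrientations Ḡ
  complement-has-orientation = ∈.∈-length (acyclicOrientations-intro Ḡ
    (orientBy-acyclic Ḡ toℕ Ḡ-sym λ uv e → Ḡ-edge⇒≢ uv (Fin.toℕ-injective e)))

  module _ {O : Orientation n} (O-acyclic : IsAcyclicOrientation G O) {a v b : Fin n}
           (a→b : arc O a b ≡ true) (¬av : G a v ≡ false) (¬vb : G v b ≡ false) where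

    private
      ab : G a b ≡ true
      ab = AcyclicOrientation.arc⇒edge G O O-acyclic a→b
      v≢a : v ≢ a
      v≢a refl with trans (sym ab) ¬vb
      ... | ()
      v≢b : v ≢ b
      v≢b refl with trans (sym ab) ¬av
      ... | ()
      a≢b : a ≢ b
      a≢b = G-edge⇒≢ ab

    -- the orientation of the complement ranking b < v < a first
    reversed : Orientation n
    reversed = orientBy Ḡ (lead b v a)

    reversed-acyclic : reversed ∈ acyclicOrientations Ḡ
    reversed-acyclic = acyclicOrientations-intro Ḡ
      (orientBy-acyclic Ḡ (lead b v a) Ḡ-sym λ uv e → Ḡ-edge⇒≢ uv (lead-injective e))

    reversed-missed : ∀ {f} → f ∈ linearExtensions O → toḠ f ≢ reversed
    reversed-missed {f} f∈ same = ℕ.<-asym (ℕ.<-trans f-b<v f-v<a) f-a<b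
      where
      follows-key : ∀ {x y} → Ḡ x y ≡ true → lead b v a x < lead b v a y → pos f x < pos f y
      follows-key {x} {y} xy lt = orientBy-arc⇒< Ḡ (pos f) (subst (λ A → arc A x y ≡ true)
        (sym same) (orientBy-<⇒arc Ḡ (lead b v a) xy lt))
      f-a<b : pos f a < pos f b
      f-a<b = LinearExtension.monotone f∈ (arc⇒precedes O a→b)
      f-b<v : pos f b < pos f v
      f-b<v = follows-key (non-edge⇒Ḡ-edge (v≢b ∘ sym) (trans (G-sym b v) ¬vb))
        (subst₂ _<_ (sym (lead-x {x = b} {y = v} {z = a})) (sym (lead-y {z = a} v≢b))
                    (s≤s z≤n))
      f-v<a : pos f v < pos f a
      f-v<a = follows-key (non-edge⇒Ḡ-edge v≢a (trans (G-sym v a) ¬av))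
        (subst₂ _<_ (sym (lead-y v≢b)) (sym (lead-z a≢b (v≢a ∘ sym))) (s≤s (s≤s z≤n)))

    linearExtensions< : numLinearExtensions O < numAcyclicOrientations Ḡ
    linearExtensions< = count-inj< toḠ _ _ (linearExtensions-unique O) (toḠ-injects O-acyclic)
                          reversed-acyclic reversed-missed

  -- Whichever way O orients the edge u w, one of the two triangles
  -- applies, so every acyclic orientation of G falls short.
  ε< : ∀ {u v w} → G u v ≡ false → G v w ≡ false → G u w ≡ true →
    ε G < numAcyclicOrientations Ḡ
  ε< {u} {v} {w} ¬uv ¬vw uw = max-map-< numLinearExtensions (acyclicOrientations G)
    complement-has-orientation (falls-short ∘ acyclicOrientations-elim G)
    where
    falls-short : ∀ {O} → IsAcyclicOrientation G O →
      numLinearExtensions O < numAcyclicOrientations Ḡ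
    falls-short {O} O-acyclic with AcyclicOrientation.edge⇒arc G O O-acyclic uw
    ... | inj₁ u→w = linearExtensions< O-acyclic u→w ¬uv ¬vw
    ... | inj₂ w→u =
      linearExtensions< O-acyclic w→u (trans (G-sym w v) ¬vw) (trans (G-sym v u) ¬uv)

  equality⇒non-adjacency-transitive : ε G ≡ numAcyclicOrientations Ḡ →
    ∀ {u v w} → G u v ≡ false → G v w ≡ false → G u w ≡ false
  equality⇒non-adjacency-transitive attained {u} {v} {w} ¬uv ¬vw with G u w in uw
  ... | false = refl
  ... | true = ⊥-elim (ℕ.<-irrefl attained (ε< ¬uv ¬vw uw))

-- Conversely, a simple graph whose non-adjacency is transitive is complete
-- multipartite: non-adjacency is then an equivalence relation (reflexive
-- as G is loopless) and its classes are the parts.  One representative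
-- per class is chosen by scanning the vertices; a vertex's part is the
-- index of its representative.

module PartsFromNonAdjacency {n : ℕ} (G : Graph n) (simple : IsSimple G)
  (non-adjacency-transitive : ∀ {u v w} → G u v ≡ false → G v w ≡ false → G u w ≡ false) where
  open Complement G simple using (G-sym; G-loopless)

  Covers : List (Fin n) → List (Fin n) → Set
  Covers rs xs = ∀ {u} → u ∈ xs → ∃ λ (i : Fin (length rs)) → G (List.lookup rs i) u ≡ false

  Separated : List (Fin n) → Set
  Separated rs = ∀ i j → G (List.lookup rs i) (List.lookup rs j) ≡ false → i ≡ j

  representatives : (xs : List (Fin n)) → Σ (List (Fin n)) λ rs → Covers rs xs × Separated rs
  representatives [] = [] , (λ ()) , (λ ())
  representatives (x ∷ xs) with representatives xs
  ... | rs , covers , separated with Fin.any? (λ i → G (List.lookup rs i) x Bool.≟ false)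
  ...   | yes (i , ¬ix) = rs , covers′ , separated
    where
    covers′ : Covers rs (x ∷ xs)
    covers′ (here refl) = i , ¬ix
    covers′ (there u∈xs) = covers u∈xs
  ...   | no new = x ∷ rs , covers′ , separated′
    where
    covers′ : Covers (x ∷ rs) (x ∷ xs)
    covers′ (here refl) = Fin.zero , G-loopless x
    covers′ (there u∈xs) with covers u∈xs
    ... | i , ¬iu = Fin.suc i , ¬iu
    separated′ : Separated (x ∷ rs)
    separated′ Fin.zero Fin.zero _ = refl
    separated′ Fin.zero (Fin.suc j) ¬xj = ⊥-elim (new (j , trans (G-sym _ x) ¬xj))
    separated′ (Fin.suc i) Fin.zero ¬ix = ⊥-elim (new (i , ¬ix))
    separated′ (Fin.suc i) (Fin.suc j) ¬ij = cong Fin.suc (separated i j ¬ij)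

  reps : List (Fin n)
  reps = proj₁ (representatives (allFin n))

  p : ℕ
  p = length reps

  part : Fin n → Fin p
  part u = proj₁ (proj₁ (proj₂ (representatives (allFin n))) (∈.∈-allFin u))

  in-part : ∀ u → G (List.lookup reps (part u)) u ≡ false
  in-part u = proj₂ (proj₁ (proj₂ (representatives (allFin n))) (∈.∈-allFin u))

  separated : Separated reps
  separated = proj₂ (proj₂ (representatives (allFin n)))

  part-onto : ∀ k → ∃ λ u → part u ≡ k
  part-onto k = List.lookup reps k , separated _ _ (in-part (List.lookup reps k))

  -- vertices of the same part are non-adjacent, via their representative
  same-part⇒non-edge : ∀ {u v} → part u ≡ part v → G u v ≡ false
  same-part⇒non-edge {u} {v} same = non-adjacency-transitive (trans (G-sym u _) (in-part u))
    (subst (λ i → G (List.lookup reps i) v ≡ false) (sym same) (in-part v))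

  -- non-adjacent vertices have non-adjacent, hence equal, representatives
  non-edge⇒same-part : ∀ {u v} → G u v ≡ false → part u ≡ part v
  non-edge⇒same-part {u} {v} ¬uv = separated _ _ (non-adjacency-transitive
    (non-adjacency-transitive (in-part u) ¬uv) (trans (G-sym v _) (in-part v)))

  partite : ∀ u v → (G u v ≡ true) ⇔ (¬ part u ≡ part v)
  partite u v = mk⇔ edge⇒different different⇒edge
    where
    edge⇒different : G u v ≡ true → ¬ part u ≡ part v
    edge⇒different uv same with trans (sym uv) (same-part⇒non-edge same)
    ... | ()
    different⇒edge : ¬ part u ≡ part v → G u v ≡ true
    different⇒edge different with G u v in uv
    ... | true = refl
    ... | false = ⊥-elim (different (non-edge⇒same-part uv))

  -- the representatives are distinct vertices
  p≤n : p ≤ n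
  p≤n = Fin.injective⇒≤ {f = List.lookup reps} λ {i} {j} same →
    separated i j (trans (cong (G (List.lookup reps i)) (sym same)) (G-loopless _))

  completeMultipartite : 1 ≤ n → IsCompleteMultipartite G
  completeMultipartite n≥1 = p , p≥1 , p≤n , part , part-onto , partite
    where
    p≥1 : 1 ≤ p
    p≥1 = ℕ.≤-<-trans z≤n (Fin.toℕ<n (part (fromℕ< n≥1)))

proposition4p7 : ∀ {n : ℕ} (G : Graph n) → 1 ≤ n → IsSimple G →
    (ε G ≤ numAcyclicOrientations (complement G))
    × ((ε G ≡ numAcyclicOrientations (complement G)) ⇔ IsCompleteMultipartite G)
proposition4p7 G n≥1 simple = ε≤ , mk⇔ attained⇒multipartite multipartite⇒attained
  where
  open Complement G simple using (ε≤)

  attained⇒multipartite : ε G ≡ numAcyclicOrientations (complement G) → IsCompleteMultipartite G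
  attained⇒multipartite attained = PartsFromNonAdjacency.completeMultipartite G simple
    (NonTransitiveNonAdjacency.equality⇒non-adjacency-transitive G simple attained) n≥1

  multipartite⇒attained : IsCompleteMultipartite G → ε G ≡ numAcyclicOrientations (complement G)
  multipartite⇒attained (_ , _ , _ , c , _ , partite) =
    ℕ.≤-antisym ε≤ (CompleteMultipartite.complement≤ε G simple c partite)
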